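{- Let $\hat A$ and $\hat B$ be change actions with $\hat B$ ordered, and let $f:A\to B$ be a function. Suppose $f$ has derivatives $\partial_\bot f$ and $\partial_\top f$ which are, respectively, the unique minimal and the unique maximal derivative of $f$ with respect to the pointwise relation $\le_\Delta$. Then the derivatives of $f$ are precisely the functions $\partial f:A\times\Delta A\to\Delta B$ with $\partial_\bot f\le_\Delta\partial f\le_\Delta\partial_\top f$.
   Context: A change action $\hat A=(A,\Delta A,\oplus,+,0)$ consists of a set $A$, a monoid $(\Delta A,+,0)$ and a map $\oplus:A\times\Delta A\to A$ with $a\oplus 0=a$ and $a\oplus(\delta_1+\delta_2)=(a\oplus\delta_1)\oplus\delta_2$. A derivative of $f:A\to B$ is a function $\partial f:A\times\Delta A\to\Delta B$ with $f(a\oplus_A\delta)=f(a)\oplus_B\partial f(a,\delta)$ for all $a,\delta$. $\hat B$ is ordered if $B$ and $\Delta B$ are posets and $\oplus_B$ and $+_B$ are monotone. For $\delta_1,\delta_2\in\Delta B$, $\delta_1\le_\Delta\delta_2$ means $b\oplus_B\delta_1\le b\oplus_B\delta_2$ for all $b\in B$, extended pointwise to functions $A\times\Delta A\to\Delta B$. -}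

module Defs where

open import Level using (Level; _⊔_; suc)
open import Data.Product using (_×_)
open import Relation.Binary.PropositionalEquality using (_≡_)
open import Relation.Binary.Structures using (IsPartialOrder)
open import Algebra.Structures using (IsMonoid)

record ChangeAction (a d : Level) : Set (suc (a ⊔ d)) where
  infixl 6 _⊕_
  infixl 7 _+Δ_
  field
    A      : Set a
    ΔA     : Set d
    _⊕_    : A → ΔA → A
    _+Δ_   : ΔA → ΔA → ΔA
    0Δ     : ΔA
    isMonoid : IsMonoid _≡_ _+Δ_ 0Δ
    ⊕-identity : ∀ x → x ⊕ 0Δ ≡ x
    ⊕-action   : ∀ x δ₁ δ₂ → x ⊕ (δ₁ +Δ δ₂) ≡ (x ⊕ δ₁) ⊕ δ₂

open ChangeAction public

record IsOrdered {a d : Level} (ℓ₁ ℓ₂ : Level) (Â : ChangeAction a d)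
       : Set (suc (a ⊔ d ⊔ ℓ₁ ⊔ ℓ₂)) where
  field
    _≤_   : A Â → A Â → Set ℓ₁
    _≤δ_  : ΔA Â → ΔA Â → Set ℓ₂
    ≤-isPartialOrder  : IsPartialOrder _≡_ _≤_
    ≤δ-isPartialOrder : IsPartialOrder _≡_ _≤δ_
    ⊕-mono : ∀ {x y δ ε} → x ≤ y → δ ≤δ ε → _⊕_ Â x δ ≤ _⊕_ Â y ε
    +-mono : ∀ {δ₁ δ₂ ε₁ ε₂} → δ₁ ≤δ δ₂ → ε₁ ≤δ ε₂ →
             _+Δ_ Â δ₁ ε₁ ≤δ _+Δ_ Â δ₂ ε₂

open IsOrdered public

module _ {a₁ d₁ a₂ d₂ : Level} (Â : ChangeAction a₁ d₁) (B̂ : ChangeAction a₂ d₂) where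

  IsDerivative : (A Â → A B̂) → (A Â → ΔA Â → ΔA B̂) → Set (a₁ ⊔ d₁ ⊔ a₂)
  IsDerivative f ∂f = ∀ x δ → f (_⊕_ Â x δ) ≡ _⊕_ B̂ (f x) (∂f x δ)

module _ {a₁ d₁ a₂ d₂ ℓ₁ ℓ₂ : Level} (Â : ChangeAction a₁ d₁) (B̂ : ChangeAction a₂ d₂)
         (ord : IsOrdered ℓ₁ ℓ₂ B̂) where

  _≤Δ_ : ΔA B̂ → ΔA B̂ → Set (a₂ ⊔ ℓ₁)
  δ₁ ≤Δ δ₂ = ∀ b → _≤_ ord (_⊕_ B̂ b δ₁) (_⊕_ B̂ b δ₂)

  _≤Δ→_ : (A Â → ΔA Â → ΔA B̂) → (A Â → ΔA Â → ΔA B̂) → Set (a₁ ⊔ d₁ ⊔ a₂ ⊔ ℓ₁)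
  g ≤Δ→ h = ∀ x δ → g x δ ≤Δ h x δ

module Submission where

open import Defs
open import Level using (Level)
open import Data.Product using (_×_; _,_)
open import Function.Bundles using (_⇔_; mk⇔)
open import Relation.Binary.PropositionalEquality using (sym; subst)
open import Relation.Binary.Structures using (IsPartialOrder)

module _ {a₁ d₁ a₂ d₂ ℓ₁ ℓ₂ : Level}
         (Â : ChangeAction a₁ d₁) (B̂ : ChangeAction a₂ d₂) (ord : IsOrdered ℓ₁ ℓ₂ B̂)
         {f : A Â → A B̂} where

  -- Both bounds are derivatives, so at b = f x the comparisons read
  -- f (x ⊕ δ) ≤ f x ⊕ ∂f x δ ≤ f (x ⊕ δ), and antisymmetry closes the gap.
  derivative-between-derivatives :
    ∀ {∂⊥f ∂f ∂⊤f : A Â → ΔA Â → ΔA B̂} →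
    IsDerivative Â B̂ f ∂⊥f → IsDerivative Â B̂ f ∂⊤f →
    _≤Δ→_ Â B̂ ord ∂⊥f ∂f → _≤Δ→_ Â B̂ ord ∂f ∂⊤f →
    IsDerivative Â B̂ f ∂f
  derivative-between-derivatives {∂f = ∂f} ∂⊥f-deriv ∂⊤f-deriv ∂⊥f≤∂f ∂f≤∂⊤f x δ =
    antisym lower upper
    where
      open IsPartialOrder (≤-isPartialOrder ord) using (antisym)
      _≤B_ = _≤_ ord
      lower : f (_⊕_ Â x δ) ≤B _⊕_ B̂ (f x) (∂f x δ)
      lower = subst (_≤B _⊕_ B̂ (f x) (∂f x δ)) (sym (∂⊥f-deriv x δ)) (∂⊥f≤∂f x δ (f x))
      upper : _⊕_ B̂ (f x) (∂f x δ) ≤B f (_⊕_ Â x δ)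
      upper = subst (_⊕_ B̂ (f x) (∂f x δ) ≤B_) (sym (∂⊤f-deriv x δ)) (∂f≤∂⊤f x δ (f x))

mainTheorem7 : {a₁ d₁ a₂ d₂ ℓ₁ ℓ₂ : Level}
    (Â : ChangeAction a₁ d₁) (B̂ : ChangeAction a₂ d₂) (ord : IsOrdered ℓ₁ ℓ₂ B̂)
    (f : A Â → A B̂) (∂⊥f ∂⊤f : A Â → ΔA Â → ΔA B̂) →
    IsDerivative Â B̂ f ∂⊥f →
    IsDerivative Â B̂ f ∂⊤f →
    (∀ ∂f → IsDerivative Â B̂ f ∂f → _≤Δ→_ Â B̂ ord ∂⊥f ∂f) →
    (∀ ∂f → IsDerivative Â B̂ f ∂f → _≤Δ→_ Â B̂ ord ∂f ∂⊤f) →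
    (∂f : A Â → ΔA Â → ΔA B̂) →
    IsDerivative Â B̂ f ∂f ⇔ (_≤Δ→_ Â B̂ ord ∂⊥f ∂f × _≤Δ→_ Â B̂ ord ∂f ∂⊤f)
mainTheorem7 Â B̂ ord f ∂⊥f ∂⊤f ∂⊥f-deriv ∂⊤f-deriv ∂⊥f-least ∂⊤f-greatest ∂f =
  mk⇔ (λ ∂f-deriv → ∂⊥f-least ∂f ∂f-deriv , ∂⊤f-greatest ∂f ∂f-deriv)
      (λ (∂⊥f≤∂f , ∂f≤∂⊤f) →
         derivative-between-derivatives Â B̂ ord ∂⊥f-deriv ∂⊤f-deriv ∂⊥f≤∂f ∂f≤∂⊤f)
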